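{- Let $\ell>2$ be an integer and let $\lambda$ be a partition which is not an $(\ell,0)$-JM partition. If $\mu$ is a partition obtained from $\lambda$ by adding a horizontal or a vertical $\ell$-rim hook (i.e. $\lambda\subseteq\mu$ and $\mu\setminus\lambda$ is an $\ell$-rim hook of $\mu$ contained in a single row or in a single column), then $\mu$ is not an $(\ell,0)$-JM partition.
   Context: Partitions are identified with their Young diagrams; $(x,y)$ denotes the box in row $x$, column $y$. The hook length $h^\lambda_{(a,c)}$ of a box $(a,c)\in\lambda$ is the number of boxes of $\lambda$ to the right of it in its row or below it in its column, including itself. A partition $\lambda$ is an $(\ell,0)$-JM partition if there do NOT exist boxes $(a,b)$, $(a,y)$, $(x,b)$ in $\lambda$ with $\ell\mid h^\lambda_{(a,b)}$, $\ell\nmid h^\lambda_{(a,y)}$, $\ell\nmid h^\lambda_{(x,b)}$. An $\ell$-rim hook of a partition is a connected (edge-adjacency) set of $\ell$ boxes of its Young diagram containing no $2\times 2$ square whose removal leaves the Young diagram of a partition. It is horizontal if contained in one row, vertical if contained in one column. -}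

module Defs where

open import Data.Nat using (ℕ; zero; suc; _+_; _∸_; _≤_; _<_; _<?_)
open import Data.Nat.Divisibility using (_∣_)
open import Data.List using (List; []; _∷_; length)
open import Data.List.Membership.Propositional using (_∈_)
open import Data.List.Relation.Unary.Unique.Propositional using (Unique)
open import Data.Product using (Σ; ∃; _×_; _,_; proj₁; proj₂)
open import Data.Sum using (_⊎_)
open import Relation.Nullary using (¬_; yes; no)
open import Relation.Binary.PropositionalEquality using (_≡_)
open import Relation.Binary.Construct.Closure.ReflexiveTransitive using (Star)
open import Function.Bundles using (_⇔_)

-- A partition is given by its list of row lengths (rows indexed from 0).
-- Beyond the end of the list, rows have length 0.
row : List ℕ → ℕ → ℕ
row []       _       = 0
row (r ∷ rs) zero    = r
row (r ∷ rs) (suc i) = row rs i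

-- weakly decreasing row lengths (trailing zeros allowed; they do not
-- change the Young diagram)
IsPartition : List ℕ → Set
IsPartition p = ∀ i → row p (suc i) ≤ row p i

Box : Set
Box = ℕ × ℕ

-- Young diagram membership: box (x , y) = row x, column y (0-indexed)
_∈ᵇ_ : Box → List ℕ → Set
(x , y) ∈ᵇ p = y < row p x

col : List ℕ → ℕ → ℕ
col []       y = 0
col (r ∷ rs) y with y <? r
... | yes _ = suc (col rs y)
... | no  _ = col rs y

hook : List ℕ → ℕ → ℕ → ℕ
hook p x y = (row p x ∸ y) + (col p y ∸ suc x)

IsJM : ℕ → List ℕ → Set
IsJM ℓ p = ¬ (Σ ℕ λ a → Σ ℕ λ b → Σ ℕ λ x → Σ ℕ λ y →
                (a , b) ∈ᵇ p × (a , y) ∈ᵇ p × (x , b) ∈ᵇ p ×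
                ℓ ∣ hook p a b × ¬ (ℓ ∣ hook p a y) × ¬ (ℓ ∣ hook p x b))

_⊆ᵖ_ : List ℕ → List ℕ → Set
p ⊆ᵖ q = ∀ b → b ∈ᵇ p → b ∈ᵇ q

_∖ᵖ_ : List ℕ → List ℕ → Box → Set
(q ∖ᵖ p) b = b ∈ᵇ q × ¬ (b ∈ᵇ p)

Adj : Box → Box → Set
Adj (x , y) (x' , y') =
  (x ≡ x' × (suc y ≡ y' ⊎ y ≡ suc y')) ⊎ (y ≡ y' × (suc x ≡ x' ⊎ x ≡ suc x'))

Connected : (Box → Set) → Set
Connected S = ∀ b b' → S b → S b' →
  Star (λ c c' → S c × S c' × Adj c c') b b'

No2x2 : (Box → Set) → Set
No2x2 S = ¬ (Σ ℕ λ x → Σ ℕ λ y →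
  S (x , y) × S (suc x , y) × S (x , suc y) × S (suc x , suc y))

HasCard : (Box → Set) → ℕ → Set
HasCard S n = Σ (List Box) λ L → length L ≡ n × Unique L × (∀ b → (b ∈ L ⇔ S b))

IsRimHook : ℕ → List ℕ → (Box → Set) → Set
IsRimHook ℓ q S =
  (∀ b → S b → b ∈ᵇ q) ×
  HasCard S ℓ ×
  Connected S ×
  No2x2 S ×
  (Σ (List ℕ) λ ν → IsPartition ν × (∀ b → (b ∈ᵇ ν ⇔ (b ∈ᵇ q × ¬ S b))))

Horizontal : (Box → Set) → Set
Horizontal S = Σ ℕ λ x → ∀ b → S b → proj₁ b ≡ x

Vertical : (Box → Set) → Set
Vertical S = Σ ℕ λ y → ∀ b → S b → proj₂ b ≡ y

module Submission where

-- We work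
-- with abstract Young diagrams: row and column length functions linked by
-- the duality  y < rowLen x  ⇔  x < colLen y.  If E lengthens row r of D by
-- ℓ boxes, occupying columns s, …, s+ℓ-1, then every column j of D has a
-- partner column j' of E (j itself outside the strip, j+1 inside it, and s
-- for the last strip column) such that each box (i,j) of D becomes a box
-- (i,j') of E whose hook length is unchanged or larger by exactly ℓ.  This
-- congruence modulo ℓ transports a witness from D to E.  The vertical case
-- follows by transposing.  Finally, a horizontal (vertical) skew shape
-- mu ∖ la with ℓ boxes makes row (column) r of mu exactly ℓ longer than
-- that of la, all other rows (columns) being equal; this is a counting
-- argument on duplicate-free lists.

open import Defs
open import Data.Nat
open import Data.Nat.Properties
open import Data.Nat.Divisibility using (_∣_; ∣-refl; ∣m∣n⇒∣m+n; ∣m+n∣m⇒∣n)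
open import Data.Nat.Tactic.RingSolver using (solve-∀)
open import Data.List using (List; []; _∷_; length; map; applyUpTo)
open import Data.List.Properties using (length-map; length-applyUpTo)
open import Data.List.Membership.Propositional using (_∈_)
open import Data.List.Membership.Propositional.Properties
  using (∈-map⁺; ∈-map⁻; ∈-applyUpTo⁺; ∈-applyUpTo⁻)
open import Data.List.Membership.Propositional.Properties.WithK using (unique∧set⇒bag)
open import Data.List.Relation.Binary.BagAndSetEquality using (∼bag⇒↭)
open import Data.List.Relation.Binary.Permutation.Propositional.Properties using (↭-length)
open import Data.List.Relation.Unary.Unique.Propositional using (Unique)
open import Data.List.Relation.Unary.Unique.Propositional.Properties using (map⁺; applyUpTo⁺₁)
open import Data.Product using (Σ; _×_; _,_; proj₁; proj₂; swap)
open import Data.Sum using (_⊎_; inj₁; inj₂)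
open import Function using (_∘_)
open import Function.Bundles using (_⇔_; mk⇔; Equivalence)
open import Function.Properties.Equivalence using ()
  renaming (refl to ⇔-refl; sym to ⇔-sym; trans to ⇔-trans)
open import Relation.Binary.PropositionalEquality
open import Relation.Nullary using (¬_; yes; no; contradiction)
open import Relation.Nullary.Decidable using (decidable-stable)

open Equivalence using (to; from)

Shifted : ℕ → ℕ → ℕ → Set
Shifted ℓ p q = p ≡ q ⊎ p ≡ q + ℓ

shifted-∣ : ∀ {ℓ p q} → Shifted ℓ p q → ℓ ∣ p ⇔ ℓ ∣ q
shifted-∣ (inj₁ refl) = ⇔-refl
shifted-∣ {ℓ} {q = q} (inj₂ refl) =
  mk⇔ (λ ℓ∣q+ℓ → ∣m+n∣m⇒∣n (subst (ℓ ∣_) (+-comm q ℓ) ℓ∣q+ℓ) ∣-refl)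
      (λ ℓ∣q → ∣m∣n⇒∣m+n ℓ∣q ∣-refl)

∸-suc : ∀ {m n} → n < m → m ∸ n ≡ suc (m ∸ suc n)
∸-suc = +-∸-assoc 1

∸-split : ∀ A s ℓ → s + ℓ ≤ A → A ∸ s ≡ (A ∸ (s + ℓ)) + ℓ
∸-split A       zero    ℓ le        = sym (m∸n+n≡m le)
∸-split (suc A) (suc s) ℓ (s≤s le) = ∸-split A s ℓ le

<-ext : ∀ {a b} → (∀ n → n < a ⇔ n < b) → a ≡ b
<-ext {a} {b} same = ≤-antisym
  (≮⇒≥ λ b<a → <-irrefl refl (to (same b) b<a))
  (≮⇒≥ λ a<b → <-irrefl refl (from (same a) a<b))

record Diagram : Set where
  field
    rowLen colLen : ℕ → ℕ
    galois        : ∀ x y → y < rowLen x ⇔ x < colLen y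
open Diagram

_∈ᴰ_ : Box → Diagram → Set
(x , y) ∈ᴰ D = y < rowLen D x

_⊆ᴰ_ : Diagram → Diagram → Set
D ⊆ᴰ E = ∀ b → b ∈ᴰ D → b ∈ᴰ E

hookLen : Diagram → ℕ → ℕ → ℕ
hookLen D x y = (rowLen D x ∸ y) + (colLen D y ∸ suc x)

NonJM : ℕ → Diagram → Set
NonJM ℓ D = Σ ℕ λ a → Σ ℕ λ b → Σ ℕ λ x → Σ ℕ λ y →
  (a , b) ∈ᴰ D × (a , y) ∈ᴰ D × (x , b) ∈ᴰ D ×
  ℓ ∣ hookLen D a b × ¬ (ℓ ∣ hookLen D a y) × ¬ (ℓ ∣ hookLen D x b)

rowLen-antitone : ∀ D {i i'} → i ≤ i' → rowLen D i' ≤ rowLen D i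
rowLen-antitone D {i} {i'} i≤i' = ≮⇒≥ λ lt → <-irrefl refl
  (from (galois D i _) (≤-<-trans i≤i' (to (galois D i' _) lt)))

colLen-from-rows : ∀ D j c → (∀ n → j < rowLen D n ⇔ n < c) → colLen D j ≡ c
colLen-from-rows D j c rows = <-ext λ n → ⇔-trans (⇔-sym (galois D n j)) (rows n)

transpose : Diagram → Diagram
transpose D = record
  { rowLen = colLen D ; colLen = rowLen D ; galois = λ x y → ⇔-sym (galois D y x) }

∈-transpose : ∀ D b → b ∈ᴰ transpose D ⇔ swap b ∈ᴰ D
∈-transpose D (x , y) = ⇔-sym (galois D y x)

-- Transposition exchanges arm and leg, so it preserves hook lengths.
hook-transpose : ∀ D {x y} → (x , y) ∈ᴰ D → hookLen (transpose D) y x ≡ hookLen D x y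
hook-transpose D {x} {y} y<row = begin
  (colLen D y ∸ x) + arm         ≡⟨ cong (_+ arm) (∸-suc x<col) ⟩
  suc leg + arm                  ≡⟨ cong suc (+-comm leg arm) ⟩
  suc arm + leg                  ≡⟨ cong (_+ leg) (sym (∸-suc y<row)) ⟩
  (rowLen D x ∸ y) + leg         ∎
  where
  open ≡-Reasoning
  arm = rowLen D x ∸ suc y
  leg = colLen D y ∸ suc x
  x<col = to (galois D x y) y<row

nonJM-transpose : ∀ {ℓ} D → NonJM ℓ D → NonJM ℓ (transpose D)
nonJM-transpose {ℓ} D (a , b , x , y , ab , ay , xb , ℓ∣ab , ℓ∤ay , ℓ∤xb) =
  b , a , y , x , flip ab , flip xb , flip ay ,
  subst (ℓ ∣_) (sym (hook-transpose D ab)) ℓ∣ab ,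
  ℓ∤xb ∘ subst (ℓ ∣_) (hook-transpose D xb) ,
  ℓ∤ay ∘ subst (ℓ ∣_) (hook-transpose D ay)
  where
  flip : ∀ {p q} → (p , q) ∈ᴰ D → (q , p) ∈ᴰ transpose D
  flip {p} {q} = to (galois D p q)

RowStrip : ℕ → Diagram → Diagram → ℕ → Set
RowStrip ℓ D E r = rowLen E r ≡ rowLen D r + ℓ × (∀ i → i ≢ r → rowLen E i ≡ rowLen D i)

module HorizontalStrip {ℓ : ℕ} (D E : Diagram) (r : ℕ)
                       (grow : rowLen E r ≡ rowLen D r + ℓ)
                       (keep : ∀ i → i ≢ r → rowLen E i ≡ rowLen D i) where
  open ≡-Reasoning

  -- the strip occupies columns s, …, s + ℓ - 1 of row r
  s : ℕ
  s = rowLen D r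

  D⊆E : D ⊆ᴰ E
  D⊆E (i , j) j<D with i ≟ r
  ... | yes refl = subst (j <_) (sym grow) (<-≤-trans j<D (m≤m+n s ℓ))
  ... | no  i≢r  = subst (j <_) (sym (keep i i≢r)) j<D

  reaches-strip : ∀ {n j} → n ≤ r → j < s + ℓ → j < rowLen E n
  reaches-strip {n} n≤r j< = <-≤-trans j< (subst (_≤ rowLen E n) grow (rowLen-antitone E n≤r))

  misses-strip : ∀ {n j} → r ≤ n → s ≤ j → ¬ j < rowLen D n
  misses-strip r≤n s≤j = ≤⇒≯ (≤-trans (rowLen-antitone D r≤n) s≤j)

  rows-off-strip : ∀ {j} → j < s ⊎ s + ℓ ≤ j → ∀ n → j < rowLen E n ⇔ j < rowLen D n
  rows-off-strip {j} out n with n ≟ r | out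
  ... | no n≢r   | _        = subst (λ m → j < m ⇔ j < rowLen D n) (sym (keep n n≢r)) ⇔-refl
  ... | yes refl | inj₁ j<s = subst (λ m → j < m ⇔ j < s) (sym grow)
                                (mk⇔ (λ _ → j<s) (λ _ → <-≤-trans j<s (m≤m+n s ℓ)))
  ... | yes refl | inj₂ le  = subst (λ m → j < m ⇔ j < s) (sym grow)
                                (mk⇔ (λ j< → contradiction j< (≤⇒≯ le))
                                     (λ j< → contradiction j< (≤⇒≯ (≤-trans (m≤m+n s ℓ) le))))

  above-strip : ∀ {i j} → s ≤ j → (i , j) ∈ᴰ D → i < r
  above-strip {i} s≤j j<D = decidable-stable (i <? r) λ i≮r → misses-strip (≮⇒≥ i≮r) s≤j j<D

  colLen-outside : ∀ {j} → j < s ⊎ s + ℓ ≤ j → colLen E j ≡ colLen D j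
  colLen-outside {j} out = colLen-from-rows E j (colLen D j) λ n →
    ⇔-trans (rows-off-strip out n) (galois D n j)

  colLenD-strip : ∀ {j} → s ≤ j → j < s + ℓ → colLen D j ≡ r
  colLenD-strip {j} s≤j j< = colLen-from-rows D j r λ n →
    mk⇔ (above-strip s≤j)
        (λ n<r → subst (j <_) (keep n (<⇒≢ n<r)) (reaches-strip (<⇒≤ n<r) j<))

  colLenE-strip : ∀ {j} → s ≤ j → j < s + ℓ → colLen E j ≡ suc r
  colLenE-strip {j} s≤j j< = colLen-from-rows E j (suc r) λ n →
    mk⇔ (λ j<E → decidable-stable (n <? suc r) λ n≮1+r →
           let r<n = ≮⇒≥ n≮1+r in
           misses-strip (<⇒≤ r<n) s≤j (subst (j <_) (keep n (>⇒≢ r<n)) j<E))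
        (λ n<1+r → reaches-strip (<⇒≤pred n<1+r) j<)

  Matches : ℕ → ℕ → Set
  Matches j j' = ∀ i → (i , j) ∈ᴰ D →
    (i , j') ∈ᴰ E × Shifted ℓ (hookLen E i j') (hookLen D i j)

  -- Columns off the strip keep their place; only row r gains ℓ in its arm.
  match-outside : ∀ {j} → j < s ⊎ s + ℓ ≤ j → Matches j j
  match-outside {j} out i j<D = D⊆E (i , j) j<D , shifted
    where
    leg = colLen D j ∸ suc i
    shifted : Shifted ℓ (hookLen E i j) (hookLen D i j)
    shifted with i ≟ r
    ... | no i≢r =
      inj₁ (cong₂ _+_ (cong (_∸ j) (keep i i≢r)) (cong (_∸ suc i) (colLen-outside out)))
    ... | yes refl = inj₂ (begin
      (rowLen E r ∸ j) + (colLen E j ∸ suc r)  ≡⟨ cong₂ _+_ (cong (_∸ j) grow)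
                                                            (cong (_∸ suc r) (colLen-outside out)) ⟩
      (s + ℓ ∸ j) + leg                        ≡⟨ cong (_+ leg) (+-∸-comm ℓ (<⇒≤ j<D)) ⟩
      (s ∸ j) + ℓ + leg                        ≡⟨ swap-last (s ∸ j) ℓ leg ⟩
      (s ∸ j) + leg + ℓ                        ∎)
      where
      swap-last : ∀ u v w → u + v + w ≡ u + w + v
      swap-last = solve-∀

  hookD-strip : ∀ {i j} → s ≤ j → j < s + ℓ → hookLen D i j ≡ (rowLen D i ∸ j) + (r ∸ suc i)
  hookD-strip {i} {j} s≤j j< = cong (λ c → (rowLen D i ∸ j) + (c ∸ suc i)) (colLenD-strip s≤j j<)

  hookE-strip : ∀ {i j} → i < r → s ≤ j → j < s + ℓ → hookLen E i j ≡ (rowLen D i ∸ j) + (r ∸ i)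
  hookE-strip {i} {j} i<r s≤j j< =
    cong₂ _+_ (cong (_∸ j) (keep i (<⇒≢ i<r))) (cong (_∸ suc i) (colLenE-strip s≤j j<))

  -- A strip column other than the last moves one step right: the arm
  -- shrinks by one and the leg grows by one.
  match-inside : ∀ {j} → s ≤ j → suc j < s + ℓ → Matches j (suc j)
  match-inside {j} s≤j 1+j< i j<D = reaches-strip (<⇒≤ i<r) 1+j< , inj₁ (begin
    hookLen E i (suc j)     ≡⟨ hookE-strip i<r (≤-trans s≤j (n≤1+n j)) 1+j< ⟩
    arm + (r ∸ i)           ≡⟨ cong (arm +_) (∸-suc i<r) ⟩
    arm + suc leg           ≡⟨ +-suc arm leg ⟩
    suc arm + leg           ≡⟨ cong (_+ leg) (sym (∸-suc j<D)) ⟩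
    (rowLen D i ∸ j) + leg  ≡⟨ sym (hookD-strip s≤j (<-trans (n<1+n j) 1+j<)) ⟩
    hookLen D i j           ∎)
    where
    i<r = above-strip s≤j j<D
    arm = rowLen D i ∸ suc j
    leg = r ∸ suc i

  -- The last strip column wraps around to the first: the leg grows by one
  -- and the arm by ℓ - 1.
  match-last : ∀ {j} → s ≤ j → suc j ≡ s + ℓ → Matches j s
  match-last {j} s≤j last i j<D = reaches-strip (<⇒≤ i<r) s< , inj₂ (begin
    hookLen E i s                ≡⟨ hookE-strip i<r ≤-refl s< ⟩
    (rowLen D i ∸ s) + (r ∸ i)   ≡⟨ cong₂ _+_ arm-split (∸-suc i<r) ⟩
    arm + ℓ + suc leg            ≡⟨ regroup arm ℓ leg ⟩
    suc arm + leg + ℓ            ≡⟨ cong (λ a → a + leg + ℓ) (sym (∸-suc j<D)) ⟩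
    (rowLen D i ∸ j) + leg + ℓ   ≡⟨ cong (_+ ℓ) (sym (hookD-strip s≤j j<)) ⟩
    hookLen D i j + ℓ            ∎)
    where
    j<  = subst (j <_) last (n<1+n j)
    s<  = ≤-<-trans s≤j j<
    i<r = above-strip s≤j j<D
    arm = rowLen D i ∸ suc j
    leg = r ∸ suc i
    arm-split : rowLen D i ∸ s ≡ arm + ℓ
    arm-split = trans (∸-split (rowLen D i) s ℓ (subst (_≤ rowLen D i) last j<D))
                      (cong (λ c → (rowLen D i ∸ c) + ℓ) (sym last))
    regroup : ∀ a l g → a + l + suc g ≡ suc a + g + l
    regroup = solve-∀

  column-partner : ∀ j → Σ ℕ (Matches j)
  column-partner j with j <? s
  ... | yes j<s = j , match-outside (inj₁ j<s)
  ... | no j≮s with suc j <? s + ℓ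
  ...   | yes 1+j< = suc j , match-inside (≮⇒≥ j≮s) 1+j<
  ...   | no 1+j≮ with j <? s + ℓ
  ...     | yes j<  = s , match-last (≮⇒≥ j≮s) (≤-antisym j< (≮⇒≥ 1+j≮))
  ...     | no j≮   = j , match-outside (inj₂ (≮⇒≥ j≮))

  nonJM-preserved : NonJM ℓ D → NonJM ℓ E
  nonJM-preserved (a , b , x , y , ab , ay , xb , ℓ∣ab , ℓ∤ay , ℓ∤xb) =
    a , b' , x , y' , proj₁ (mb a ab) , proj₁ (my a ay) , proj₁ (mb x xb) ,
    from (shifted-∣ (proj₂ (mb a ab))) ℓ∣ab ,
    ℓ∤ay ∘ to (shifted-∣ (proj₂ (my a ay))) ,
    ℓ∤xb ∘ to (shifted-∣ (proj₂ (mb x xb)))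
    where
    b' = proj₁ (column-partner b)
    mb = proj₂ (column-partner b)
    y' = proj₁ (column-partner y)
    my = proj₂ (column-partner y)

nonJM-horizontal : ∀ {ℓ} D E r → RowStrip ℓ D E r → NonJM ℓ D → NonJM ℓ E
nonJM-horizontal D E r (grow , keep) = HorizontalStrip.nonJM-preserved D E r grow keep

-- Lengthening a column is lengthening a row of the transposed diagram.
nonJM-vertical : ∀ {ℓ} D E c → RowStrip ℓ (transpose D) (transpose E) c →
  NonJM ℓ D → NonJM ℓ E
nonJM-vertical D E c strip =
  nonJM-transpose (transpose E) ∘
  nonJM-horizontal (transpose D) (transpose E) c strip ∘
  nonJM-transpose D

hasCard-length : ∀ {S n} (M : List Box) → Unique M → (∀ b → b ∈ M ⇔ S b) →
  HasCard S n → n ≡ length M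
hasCard-length M uniqM M≡S (L , len , uniqL , L≡S) =
  trans (sym len) (↭-length (∼bag⇒↭ (unique∧set⇒bag uniqL uniqM same-elements)))
  where
  same-elements : ∀ {b} → b ∈ L ⇔ b ∈ M
  same-elements {b} = ⇔-trans (L≡S b) (⇔-sym (M≡S b))

hasCard-swap : ∀ {S n} → HasCard S n → HasCard (S ∘ swap) n
hasCard-swap (L , len , uniq , L≡S) =
  map swap L , trans (length-map swap L) len , map⁺ (cong swap) uniq ,
  λ b → ⇔-trans (mk⇔ (swapped-∈ b) (∈-map⁺ swap)) (L≡S (swap b))
  where
  swapped-∈ : ∀ b → b ∈ map swap L → swap b ∈ L
  swapped-∈ b p with c , c∈L , refl ← ∈-map⁻ swap p = c∈L

rowStrip : ∀ {ℓ} D E (S : Box → Set) r → D ⊆ᴰ E →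
  (∀ b → S b ⇔ (b ∈ᴰ E × ¬ b ∈ᴰ D)) → (∀ b → S b → proj₁ b ≡ r) → HasCard S ℓ →
  RowStrip ℓ D E r
rowStrip {ℓ} D E S r D⊆E S≡skew inRow card = grow , keep
  where
  a = rowLen D r
  m = rowLen E r ∸ a

  a≤E : a ≤ rowLen E r
  a≤E = ≮⇒≥ λ E<a → <-irrefl refl (D⊆E (r , rowLen E r) E<a)

  strip : List Box
  strip = applyUpTo (λ k → r , a + k) m

  strip-unique : Unique strip
  strip-unique = applyUpTo⁺₁ _ m λ i<j _ eq → <-irrefl (+-cancelˡ-≡ a _ _ (cong proj₂ eq)) i<j

  strip≡S : ∀ b → b ∈ strip ⇔ S b
  strip≡S b = mk⇔ enumerated complete
    where
    enumerated : b ∈ strip → S b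
    enumerated p with k , k<m , refl ← ∈-applyUpTo⁻ _ p =
      from (S≡skew _) (subst (a + k <_) (m+[n∸m]≡n a≤E) (+-monoʳ-< a k<m) , ≤⇒≯ (m≤m+n a k))
    complete : S b → b ∈ strip
    complete Sb with to (S≡skew b) Sb | inRow b Sb
    ... | y<E , y≮a | refl = subst (_∈ strip) (cong (r ,_) (m+[n∸m]≡n (≮⇒≥ y≮a)))
                                   (∈-applyUpTo⁺ _ (∸-monoˡ-< y<E (≮⇒≥ y≮a)))

  grow : rowLen E r ≡ a + ℓ
  grow = begin
    rowLen E r ≡⟨ sym (m+[n∸m]≡n a≤E) ⟩
    a + m      ≡⟨ cong (a +_) (sym (trans (hasCard-length strip strip-unique strip≡S card)
                                           (length-applyUpTo _ m))) ⟩
    a + ℓ      ∎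
    where open ≡-Reasoning

  keep : ∀ i → i ≢ r → rowLen E i ≡ rowLen D i
  keep i i≢r = <-ext λ y → mk⇔
    (λ y<E → decidable-stable (y <? rowLen D i) λ y≮D →
               i≢r (inRow (i , y) (from (S≡skew _) (y<E , y≮D))))
    (D⊆E (i , y))

⊆-transpose : ∀ {D E} → D ⊆ᴰ E → transpose D ⊆ᴰ transpose E
⊆-transpose {D} {E} D⊆E b = from (∈-transpose E b) ∘ D⊆E (swap b) ∘ to (∈-transpose D b)

skew-transpose : ∀ {D E} {S : Box → Set} → (∀ b → S b ⇔ (b ∈ᴰ E × ¬ b ∈ᴰ D)) →
  ∀ b → S (swap b) ⇔ (b ∈ᴰ transpose E × ¬ b ∈ᴰ transpose D)
skew-transpose {D} {E} S≡skew b = ⇔-trans (S≡skew (swap b)) (mk⇔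
  (λ (inE , notD) → from (∈-transpose E b) inE , notD ∘ to (∈-transpose D b))
  (λ (inE , notD) → to (∈-transpose E b) inE , notD ∘ from (∈-transpose D b)))

first-row-longest : ∀ r rs → IsPartition (r ∷ rs) → ∀ x → row (r ∷ rs) x ≤ r
first-row-longest r rs hp zero    = ≤-refl
first-row-longest r rs hp (suc x) = ≤-trans (hp x) (first-row-longest r rs hp x)

row⇔col : ∀ p → IsPartition p → ∀ x y → y < row p x ⇔ x < col p y
row⇔col []       hp x y = mk⇔ (λ ()) (λ ())
row⇔col (r ∷ rs) hp x y with y <? r
row⇔col (r ∷ rs) hp zero    y | yes y<r = mk⇔ (λ _ → s≤s z≤n) (λ _ → y<r)
row⇔col (r ∷ rs) hp (suc x) y | yes _   =
  mk⇔ (s≤s ∘ to (row⇔col rs (hp ∘ suc) x y)) (from (row⇔col rs (hp ∘ suc) x y) ∘ ≤-pred)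
row⇔col (r ∷ rs) hp x       y | no y≮r  =
  mk⇔ (λ y<row → contradiction (<-≤-trans y<row (first-row-longest r rs hp x)) y≮r)
      (λ x<col → contradiction (<-≤-trans (from (row⇔col rs (hp ∘ suc) x y) x<col)
                                           (first-row-longest r rs hp (suc x))) y≮r)

diagram : (p : List ℕ) → IsPartition p → Diagram
diagram p hp = record { rowLen = row p ; colLen = col p ; galois = row⇔col p hp }

-- For a partition, NonJM ℓ (diagram p hp) unfolds to the negated body of
-- IsJM ℓ p, and mu ∖ᵖ la to the skew set of the two diagrams.
lemma2p5 : (ℓ : ℕ) → 2 < ℓ → (la mu : List ℕ) →
    IsPartition la → IsPartition mu → ¬ IsJM ℓ la →
    la ⊆ᵖ mu → IsRimHook ℓ mu (mu ∖ᵖ la) →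
    (Horizontal (mu ∖ᵖ la) ⊎ Vertical (mu ∖ᵖ la)) →
    ¬ IsJM ℓ mu
lemma2p5 ℓ _ la mu pla pmu la-notJM la⊆mu (_ , card , _) straight mu-JM =
  la-notJM λ witness → mu-JM (transfer straight witness)
  where
  D = diagram la pla
  E = diagram mu pmu
  transfer : Horizontal (mu ∖ᵖ la) ⊎ Vertical (mu ∖ᵖ la) → NonJM ℓ D → NonJM ℓ E
  transfer (inj₁ (r , inRow)) =
    nonJM-horizontal D E r (rowStrip D E (mu ∖ᵖ la) r la⊆mu (λ _ → ⇔-refl) inRow card)
  transfer (inj₂ (c , inCol)) =
    nonJM-vertical D E c (rowStrip (transpose D) (transpose E) (mu ∖ᵖ la ∘ swap) c
      (⊆-transpose {D} {E} la⊆mu) (skew-transpose {D} {E} (λ _ → ⇔-refl))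
      (inCol ∘ swap) (hasCard-swap card))
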